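{- For all $t,t',t''\in\mathbb{T}^\infty$: if $t\to^\infty t'$ and $t'\to_{\beta\iota}t''$ then $t\to^\infty t''$.
   Context: Fix a countably infinite set of variables and a countable set of constructors. $\mathbb{T}^\infty$ is the set of finite and infinite terms (modulo $\alpha$-conversion) generated by $t ::= x \mid c \mid \lambda x.t \mid t\,t \mid \mathrm{case}(t;\{c_k\vec{x}_k \Rightarrow t_k \mid k=1,\dots,n\})$ ($x$ variables, $c,c_k$ constructors). One-step reduction $\to_{\beta\iota}$ is the closure under term contexts of $(\lambda x.t)t' \to t[t'/x]$ and $\mathrm{case}(c_k\vec u;\{c_l\vec x_l\Rightarrow t_l\}) \to t_k[\vec u/\vec x_k]$ ($\vec u,\vec x_k$ of the same length, variables in each $\vec x_l$ pairwise distinct, $c_l$ pairwise distinct); $\to^*$ is its reflexive–transitive closure. Infinitary reduction $\to^\infty$ is the largest relation such that whenever $t\to^\infty t'$ one of the following holds: $t'$ is a variable or constructor and $t\to^*t'$; $t'=\lambda x.r'$, $t\to^*\lambda x.r$ and $r\to^\infty r'$; $t'=r_1'r_2'$, $t\to^*r_1r_2$, $r_1\to^\infty r_1'$ and $r_2\to^\infty r_2'$; $t'=\mathrm{case}(r';\{c_k\vec x_k\Rightarrow r_k'\})$, $t\to^*\mathrm{case}(r;\{c_k\vec x_k\Rightarrow r_k\})$, $r\to^\infty r'$ and $r_k\to^\infty r_k'$ for all $k$. -}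

module Defs where

open import Data.Nat using (ℕ; zero; suc; _<_)
open import Data.Product using (_×_; Σ; ∃; proj₁; proj₂; _,_)
open import Data.Sum using (_⊎_)
open import Data.List using (List; []; _∷_; map; length)
open import Data.List.Relation.Unary.Unique.Propositional using (Unique)
open import Relation.Binary.PropositionalEquality using (_≡_; _≢_)
open import Relation.Binary.Construct.Closure.ReflexiveTransitive using (Star)

-- Infinitary terms T^∞ (finite and infinite), without coinduction
-- (--guardedness / sized types are not available): a term is given by its
-- labelling of tree positions.
-- Binders use de Bruijn indices, so α-equivalent terms coincide.
--
-- Node labels:
--   var i         : variable (de Bruijn index i), no children
--   con c         : constructor c (constructors are ℕ), no children
--   lam           : λ-abstraction, child 0 = body (under 1 binder)
--   app           : application, child 0 = function, child 1 = argument
--   case bs       : case with branches bs = [(c_1,m_1),…,(c_n,m_n)]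
--                   (constructor, number of pattern variables), the c_k
--                   pairwise distinct (irrelevant proof);
--                   child 0 = scrutinee, child (1+k) = body of branch k,
--                   which lives under m_k binders: the pattern variables
--                   x_1 … x_m, where x_m is index 0 and x_1 index m-1.

data Label : Set where
  var  : ℕ → Label
  con  : ℕ → Label
  lam  : Label
  app  : Label
  case : (bs : List (ℕ × ℕ)) → .(Unique (map proj₁ bs)) → Label

arity : Label → ℕ
arity (var _)    = 0
arity (con _)    = 0
arity lam        = 1
arity app        = 2
arity (case bs _) = suc (length bs)

nthArity : List (ℕ × ℕ) → ℕ → ℕ
nthArity []             _       = 0
nthArity ((_ , m) ∷ _)  zero    = m
nthArity (_ ∷ bs)       (suc k) = nthArity bs k

-- constructor of branch k (0 if out of range; only used for k in range)
nthCon : List (ℕ × ℕ) → ℕ → ℕ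
nthCon []             _       = 0
nthCon ((c , _) ∷ _)  zero    = c
nthCon (_ ∷ bs)       (suc k) = nthCon bs k

binders : Label → ℕ → ℕ
binders lam        zero    = 1
binders (case bs _) (suc k) = nthArity bs k
binders _          _       = 0

-- A term: labels at all positions.  Only the labels at valid positions
-- (see Valid) are meaningful; terms are compared by _≈_ below.
Tm : Set
Tm = List ℕ → Label

root : Tm → Label
root t = t []

child : Tm → ℕ → Tm
child t j p = t (j ∷ p)

data Valid (t : Tm) : List ℕ → Set where
  here  : Valid t []
  there : ∀ {j p} → j < arity (root t) → Valid (child t j) p → Valid t (j ∷ p)

_≈_ : Tm → Tm → Set
t ≈ u = ∀ p → Valid t p → t p ≡ u p

liftr : (ℕ → ℕ) → ℕ → ℕ
liftr ρ zero    = zero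
liftr ρ (suc i) = suc (ρ i)

liftr^ : ℕ → (ℕ → ℕ) → ℕ → ℕ
liftr^ zero    ρ = ρ
liftr^ (suc m) ρ = liftr (liftr^ m ρ)

renLab : (ℕ → ℕ) → Label → Label
renLab ρ (var i) = var (ρ i)
renLab ρ l       = l

ren : (ℕ → ℕ) → Tm → Tm
ren ρ t []      = renLab ρ (root t)
ren ρ t (j ∷ p) = ren (liftr^ (binders (root t) j) ρ) (child t j) p

tvar : ℕ → Tm
tvar i _ = var i

Subst : Set
Subst = ℕ → Tm

lifts : Subst → Subst
lifts σ zero    = tvar zero
lifts σ (suc i) = ren suc (σ i)

lifts^ : ℕ → Subst → Subst
lifts^ zero    σ = σ
lifts^ (suc m) σ = lifts (lifts^ m σ)

subAt : Subst → Tm → Label → List ℕ → Label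
subAt σ t (var i) p       = σ i p
subAt σ t l       []      = l
subAt σ t l       (j ∷ p) =
  subAt (lifts^ (binders l j) σ) (child t j) (root (child t j)) p

sub : Subst → Tm → Tm
sub σ t p = subAt σ t (root t) p

listSub : List Tm → Subst
listSub []       i       = tvar i
listSub (a ∷ as) zero    = a
listSub (a ∷ as) (suc i) = listSub as i

-- ConApp c s as :  s = c u_1 … u_m  with  as = [u_m, …, u_1]
data ConApp (c : ℕ) : Tm → List Tm → Set where
  nil  : ∀ {s} → root s ≡ con c → ConApp c s []
  snoc : ∀ {s as} → root s ≡ app → ConApp c (child s 0) as
       → ConApp c s (child s 1 ∷ as)

data _⟶_ : Tm → Tm → Set where
  β   : ∀ {t u} → root t ≡ app → root (child t 0) ≡ lam
      → u ≈ sub (listSub (child t 1 ∷ [])) (child (child t 0) 0) → t ⟶ u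
  ι   : ∀ {t u bs d as} (k : ℕ) → root t ≡ case bs d
      → k < length bs → ConApp (nthCon bs k) (child t 0) as
      → length as ≡ nthArity bs k
      → u ≈ sub (listSub as) (child t (suc k)) → t ⟶ u
  ctx : ∀ {t u} (j : ℕ) → root t ≡ root u → j < arity (root t)
      → child t j ⟶ child u j
      → (∀ i → i < arity (root t) → i ≢ j → child t i ≈ child u i)
      → t ⟶ u

_⟶*_ : Tm → Tm → Set
_⟶*_ = Star _⟶_

-- Infinitary reduction.  Φ R is the operator whose four clauses are those
-- of the definition (with R in place of →∞); →∞ is the largest relation
-- R with R ⊆ Φ R, i.e. the union of all post-fixed points of Φ.

data Φ (R : Tm → Tm → Set) (t t' : Tm) : Set where
  atom  : ∀ {s} → (∃ λ i → root t' ≡ var i) ⊎ (∃ λ c → root t' ≡ con c)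
        → t ⟶* s → root s ≡ root t' → Φ R t t'
  lam   : ∀ {s} → root t' ≡ lam → t ⟶* s → root s ≡ lam
        → R (child s 0) (child t' 0) → Φ R t t'
  app   : ∀ {s} → root t' ≡ app → t ⟶* s → root s ≡ app
        → R (child s 0) (child t' 0) → R (child s 1) (child t' 1) → Φ R t t'
  case  : ∀ {s bs d d'} → root t' ≡ case bs d → t ⟶* s → root s ≡ case bs d'
        → R (child s 0) (child t' 0)
        → (∀ k → k < length bs → R (child s (suc k)) (child t' (suc k)))
        → Φ R t t'

_→∞_ : Tm → Tm → Set₁
t →∞ t' = Σ (Tm → Tm → Set) λ R → (∀ a b → R a b → Φ R a b) × R t t'

-- Follow the step t' ⟶ t'' down to its redex.  Above the redex, t →∞ t' has
-- already produced the node, and one continues in the child that reduces.  At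
-- the redex, t has reduced finitely to a term with the same head, whose
-- function part (or scrutinee) reduces infinitarily to the λ-abstraction (or
-- constructor application) of the redex; since that head is produced after
-- finitely many steps, these steps can be performed inside t, creating the
-- redex in a finite reduct of t.  Contracting it leaves a substitution
-- instance, handled by the substitution lemma: a →∞ b and σ₀ i →∞ σ i for all
-- i give a[σ₀] →∞ b[σ].  Every infinitary reduction is built by exhibiting a
-- post-fixed point of Φ.

module Submission where

open import Defs
open import Data.List using (List; []; _∷_; map; length)
open import Data.List.Relation.Binary.Pointwise
  using (Pointwise; []; _∷_; Pointwise-length; symmetric; transitive)
open import Data.Maybe using (Maybe; nothing; just; maybe)
open import Data.Nat using (ℕ; zero; suc; _<_; z≤n; s≤s)
open import Data.Nat.Properties using (_≟_; n≮0)
open import Data.List.Relation.Unary.Unique.DecPropositional _≟_ using (unique?)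
open import Data.Product using (_×_; Σ; ∃; proj₁; proj₂; _,_)
open import Data.Sum using (_⊎_; inj₁; inj₂)
open import Function using (_∘_)
open import Relation.Binary.Construct.Closure.ReflexiveTransitive using (ε; _◅_; _◅◅_)
open import Relation.Binary.PropositionalEquality
open import Relation.Nullary using (contradiction; yes; no)
open import Relation.Nullary.Decidable using (recompute)

data NonVar : Label → Set where
  nvCon  : ∀ c → NonVar (con c)
  nvLam  : NonVar lam
  nvApp  : NonVar app
  nvCase : ∀ bs .d → NonVar (case bs d)

varOrNonVar : (l : Label) → (∃ λ i → l ≡ var i) ⊎ NonVar l
varOrNonVar (var i)     = inj₁ (i , refl)
varOrNonVar (con c)     = inj₂ (nvCon c)
varOrNonVar lam         = inj₂ nvLam
varOrNonVar app         = inj₂ nvApp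
varOrNonVar (case bs d) = inj₂ (nvCase bs d)

<arity⇒NonVar : ∀ {l j} → j < arity l → NonVar l
<arity⇒NonVar {lam}       _ = nvLam
<arity⇒NonVar {app}       _ = nvApp
<arity⇒NonVar {case bs d} _ = nvCase bs d

<arity-subst : ∀ {j l l'} → l ≡ l' → j < arity l → j < arity l'
<arity-subst {j} = subst (λ l → j < arity l)

renLab-NonVar : ∀ {ρ l} → NonVar l → renLab ρ l ≡ l
renLab-NonVar (nvCon c)     = refl
renLab-NonVar nvLam         = refl
renLab-NonVar nvApp         = refl
renLab-NonVar (nvCase bs d) = refl

arity-renLab : ∀ ρ l → arity (renLab ρ l) ≡ arity l
arity-renLab ρ l with varOrNonVar l
... | inj₁ (i , refl) = refl
... | inj₂ nv         = cong arity (renLab-NonVar nv)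

binders-renLab : ∀ ρ l j → binders (renLab ρ l) j ≡ binders l j
binders-renLab ρ l j with varOrNonVar l
... | inj₁ (i , refl) = refl
... | inj₂ nv         = cong (λ l → binders l j) (renLab-NonVar nv)

subAt-NonVar-root : ∀ {σ t l} → NonVar l → subAt σ t l [] ≡ l
subAt-NonVar-root (nvCon c)     = refl
subAt-NonVar-root nvLam         = refl
subAt-NonVar-root nvApp         = refl
subAt-NonVar-root (nvCase bs d) = refl

subAt-NonVar-child : ∀ {σ t l} → NonVar l → ∀ j p →
                     subAt σ t l (j ∷ p) ≡ sub (lifts^ (binders l j) σ) (child t j) p
subAt-NonVar-child (nvCon c)     j p = refl
subAt-NonVar-child nvLam         j p = refl
subAt-NonVar-child nvApp         j p = refl
subAt-NonVar-child (nvCase bs d) j p = refl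

sub-var : ∀ σ t {i} → root t ≡ var i → sub σ t ≗ σ i
sub-var σ t eq p = cong (λ l → subAt σ t l p) eq

sub-root : ∀ σ t {l} → root t ≡ l → NonVar l → root (sub σ t) ≡ l
sub-root σ t eq nv = trans (cong (λ l → subAt σ t l []) eq) (subAt-NonVar-root nv)

sub-child : ∀ σ t {l} → root t ≡ l → NonVar l → ∀ j →
            child (sub σ t) j ≗ sub (lifts^ (binders l j) σ) (child t j)
sub-child σ t eq nv j p = trans (cong (λ l → subAt σ t l (j ∷ p)) eq) (subAt-NonVar-child nv j p)

Valid-≗ : ∀ {t u p} → t ≗ u → Valid t p → Valid u p
Valid-≗ e here = here
Valid-≗ e (there {j} lt v) =
  there (<arity-subst (e []) lt) (Valid-≗ (λ q → e (j ∷ q)) v)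

Valid-≈ : ∀ {t u p} → t ≈ u → Valid t p → Valid u p
Valid-≈ e here = here
Valid-≈ e (there {j} lt v) =
  there (<arity-subst (e [] here) lt) (Valid-≈ (λ q vq → e (j ∷ q) (there lt vq)) v)

Valid-≈⁻ : ∀ {t u p} → t ≈ u → Valid u p → Valid t p
Valid-≈⁻ e here = here
Valid-≈⁻ e (there {j} lt v) = there lt' (Valid-≈⁻ (λ q vq → e (j ∷ q) (there lt' vq)) v)
  where lt' = <arity-subst (sym (e [] here)) lt

≈-refl : ∀ {t} → t ≈ t
≈-refl p _ = refl

≈-sym : ∀ {t u} → t ≈ u → u ≈ t
≈-sym e p v = sym (e p (Valid-≈⁻ e v))

≈-trans : ∀ {t u w} → t ≈ u → u ≈ w → t ≈ w
≈-trans e f p v = trans (e p v) (f p (Valid-≈ e v))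

≗⇒≈ : ∀ {t u} → t ≗ u → t ≈ u
≗⇒≈ e p _ = e p

≈-root : ∀ {t u} → t ≈ u → root t ≡ root u
≈-root e = e [] here

≈-childˡ : ∀ {t u j} → t ≈ u → j < arity (root t) → child t j ≈ child u j
≈-childˡ {j = j} e lt q v = e (j ∷ q) (there lt v)

≈-childʳ : ∀ {t u j} → t ≈ u → j < arity (root u) → child t j ≈ child u j
≈-childʳ e lt = ≈-childˡ e (<arity-subst (sym (≈-root e)) lt)

ren-cong : ∀ {ρ t t'} → t ≗ t' → ren ρ t ≗ ren ρ t'
ren-cong {ρ} e [] = cong (renLab ρ) (e [])
ren-cong {ρ} {t} {t'} e (j ∷ q) =
  trans (ren-cong (λ p → e (j ∷ p)) q)
        (cong (λ l → ren (liftr^ (binders l j) ρ) (child t' j) q) (e []))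

ren-tvar : ∀ {ρ i} → ren ρ (tvar i) ≗ tvar (ρ i)
ren-tvar [] = refl
ren-tvar {ρ} {i} (j ∷ q) = ren-tvar {ρ} {i} q

liftr-∘ : ∀ {ρ₁ ρ₂ ρ} → (∀ i → ρ₁ (ρ₂ i) ≡ ρ i) → ∀ i → liftr ρ₁ (liftr ρ₂ i) ≡ liftr ρ i
liftr-∘ h zero    = refl
liftr-∘ h (suc i) = cong suc (h i)

liftr^-∘ : ∀ {ρ₁ ρ₂ ρ} → (∀ i → ρ₁ (ρ₂ i) ≡ ρ i) → ∀ m i → liftr^ m ρ₁ (liftr^ m ρ₂ i) ≡ liftr^ m ρ i
liftr^-∘ h zero    = h
liftr^-∘ h (suc m) = liftr-∘ (liftr^-∘ h m)

renLab-∘ : ∀ {ρ₁ ρ₂ ρ} → (∀ i → ρ₁ (ρ₂ i) ≡ ρ i) → ∀ l → renLab ρ₁ (renLab ρ₂ l) ≡ renLab ρ l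
renLab-∘ h (var i)     = cong var (h i)
renLab-∘ h (con c)     = refl
renLab-∘ h lam         = refl
renLab-∘ h app         = refl
renLab-∘ h (case bs d) = refl

ren-∘ : ∀ {ρ₁ ρ₂ ρ} → (∀ i → ρ₁ (ρ₂ i) ≡ ρ i) → ∀ t → ren ρ₁ (ren ρ₂ t) ≗ ren ρ t
ren-∘ h t [] = renLab-∘ h (root t)
ren-∘ {ρ₁} {ρ₂} h t (j ∷ q) =
  trans (cong (λ m → ren (liftr^ m ρ₁) (ren (liftr^ (binders (root t) j) ρ₂) (child t j)) q)
              (binders-renLab ρ₂ (root t) j))
        (ren-∘ (liftr^-∘ h (binders (root t) j)) (child t j) q)

ren-lifts : ∀ {ρ σ σ'} → (∀ i → ren ρ (σ i) ≗ σ' i) → ∀ i → ren (liftr ρ) (lifts σ i) ≗ lifts σ' i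
ren-lifts {ρ} h zero = ren-tvar {liftr ρ} {0}
ren-lifts {ρ} {σ} h (suc i) p =
  trans (ren-∘ (λ _ → refl) (σ i) p) (trans (sym (ren-∘ (λ _ → refl) (σ i) p)) (ren-cong (h i) p))

ren-lifts^ : ∀ {ρ σ σ'} → (∀ i → ren ρ (σ i) ≗ σ' i) → ∀ m i → ren (liftr^ m ρ) (lifts^ m σ i) ≗ lifts^ m σ' i
ren-lifts^ h zero    = h
ren-lifts^ h (suc m) = ren-lifts (ren-lifts^ h m)

ren-sub : ∀ {ρ σ σ'} → (∀ i → ren ρ (σ i) ≗ σ' i) → ∀ t → ren ρ (sub σ t) ≗ sub σ' t
ren-sub {ρ} {σ} {σ'} h t p with varOrNonVar (root t)
... | inj₁ (i , eq) = trans (ren-cong (sub-var σ t eq) p) (trans (h i p) (sym (sub-var σ' t eq p)))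
ren-sub {ρ} {σ} {σ'} h t [] | inj₂ nv =
  trans (cong (renLab ρ) (sub-root σ t refl nv)) (trans (renLab-NonVar nv) (sym (sub-root σ' t refl nv)))
ren-sub {ρ} {σ} {σ'} h t (j ∷ q) | inj₂ nv =
  trans (cong (λ l → ren (liftr^ (binders l j) ρ) (child (sub σ t) j) q) (sub-root σ t refl nv))
  (trans (ren-cong (sub-child σ t refl nv j) q)
  (trans (ren-sub (ren-lifts^ h m) (child t j) q)
         (sym (sub-child σ' t refl nv j q))))
  where m = binders (root t) j

lifts-liftr : ∀ {ρ σ σ'} → (∀ i → σ (ρ i) ≗ σ' i) → ∀ i → lifts σ (liftr ρ i) ≗ lifts σ' i
lifts-liftr h zero    _ = refl
lifts-liftr h (suc i)   = ren-cong (h i)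

lifts^-liftr^ : ∀ {ρ σ σ'} → (∀ i → σ (ρ i) ≗ σ' i) → ∀ m i → lifts^ m σ (liftr^ m ρ i) ≗ lifts^ m σ' i
lifts^-liftr^ h zero    = h
lifts^-liftr^ h (suc m) = lifts-liftr (lifts^-liftr^ h m)

sub-ren : ∀ {ρ σ σ'} → (∀ i → σ (ρ i) ≗ σ' i) → ∀ t → sub σ (ren ρ t) ≗ sub σ' t
sub-ren {ρ} {σ} {σ'} h t p with varOrNonVar (root t)
... | inj₁ (i , eq) = trans (sub-var σ (ren ρ t) (cong (renLab ρ) eq) p) (trans (h i p) (sym (sub-var σ' t eq p)))
sub-ren {ρ} {σ} {σ'} h t [] | inj₂ nv =
  trans (sub-root σ (ren ρ t) (renLab-NonVar nv) nv) (sym (sub-root σ' t refl nv))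
sub-ren {ρ} {σ} {σ'} h t (j ∷ q) | inj₂ nv =
  trans (sub-child σ (ren ρ t) (renLab-NonVar nv) nv j q)
  (trans (sub-ren (lifts^-liftr^ h (binders (root t) j)) (child t j) q)
         (sym (sub-child σ' t refl nv j q)))

sub-cong : ∀ {σ t t'} → t ≗ t' → sub σ t ≗ sub σ t'
sub-cong {σ} {t} {t'} e p with varOrNonVar (root t)
... | inj₁ (i , eq) = trans (sub-var σ t eq p) (sym (sub-var σ t' (trans (sym (e [])) eq) p))
sub-cong {σ} {t} {t'} e [] | inj₂ nv = trans (sub-root σ t refl nv) (sym (sub-root σ t' (sym (e [])) nv))
sub-cong {σ} {t} {t'} e (j ∷ q) | inj₂ nv =
  trans (sub-child σ t refl nv j q)
  (trans (sub-cong (λ p → e (j ∷ p)) q)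
         (sym (sub-child σ t' (sym (e [])) nv j q)))

sub-lifts : ∀ {τ σ σ'} → (∀ i → sub σ (τ i) ≗ σ' i) → ∀ i → sub (lifts σ) (lifts τ i) ≗ lifts σ' i
sub-lifts h zero    _ = refl
sub-lifts {τ} {σ} h (suc i) p =
  trans (sub-ren {suc} {lifts σ} {λ k → ren suc (σ k)} (λ _ _ → refl) (τ i) p)
  (trans (sym (ren-sub {suc} {σ} (λ _ _ → refl) (τ i) p)) (ren-cong (h i) p))

sub-lifts^ : ∀ {τ σ σ'} → (∀ i → sub σ (τ i) ≗ σ' i) → ∀ m i → sub (lifts^ m σ) (lifts^ m τ i) ≗ lifts^ m σ' i
sub-lifts^ h zero    = h
sub-lifts^ h (suc m) = sub-lifts (sub-lifts^ h m)

sub-sub : ∀ {τ σ σ'} → (∀ i → sub σ (τ i) ≗ σ' i) → ∀ t → sub σ (sub τ t) ≗ sub σ' t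
sub-sub {τ} {σ} {σ'} h t p with varOrNonVar (root t)
... | inj₁ (i , eq) = trans (sub-cong (sub-var τ t eq) p) (trans (h i p) (sym (sub-var σ' t eq p)))
sub-sub {τ} {σ} {σ'} h t [] | inj₂ nv =
  trans (sub-root σ (sub τ t) (sub-root τ t refl nv) nv) (sym (sub-root σ' t refl nv))
sub-sub {τ} {σ} {σ'} h t (j ∷ q) | inj₂ nv =
  trans (sub-child σ (sub τ t) (sub-root τ t refl nv) nv j q)
  (trans (sub-cong (sub-child τ t refl nv j) q)
  (trans (sub-sub (sub-lifts^ h (binders (root t) j)) (child t j) q)
         (sym (sub-child σ' t refl nv j q))))

ren-cong-≈ : ∀ {ρ t t'} → t ≈ t' → ren ρ t ≈ ren ρ t'
ren-cong-≈ {ρ} e [] v = cong (renLab ρ) (≈-root e)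
ren-cong-≈ {ρ} {t} {t'} e (j ∷ q) (there lt v) =
  trans (ren-cong-≈ (≈-childˡ e (subst (j <_) (arity-renLab ρ (root t)) lt)) q v)
        (cong (λ l → ren (liftr^ (binders l j) ρ) (child t' j) q) (≈-root e))

lifts-cong-≈ : ∀ {σ σ'} → (∀ i → σ i ≈ σ' i) → ∀ i → lifts σ i ≈ lifts σ' i
lifts-cong-≈ h zero    = ≈-refl
lifts-cong-≈ h (suc i) = ren-cong-≈ (h i)

lifts^-cong-≈ : ∀ {σ σ'} → (∀ i → σ i ≈ σ' i) → ∀ m i → lifts^ m σ i ≈ lifts^ m σ' i
lifts^-cong-≈ h zero    = h
lifts^-cong-≈ h (suc m) = lifts-cong-≈ (lifts^-cong-≈ h m)

sub-cong-≈ : ∀ {σ σ' t t'} → (∀ i → σ i ≈ σ' i) → t ≈ t' → sub σ t ≈ sub σ' t'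
sub-cong-≈ {σ} {σ'} {t} {t'} h e p v with varOrNonVar (root t)
... | inj₁ (i , eq) =
  trans (sub-var σ t eq p)
  (trans (h i p (Valid-≗ (sub-var σ t eq) v)) (sym (sub-var σ' t' (trans (sym (≈-root e)) eq) p)))
sub-cong-≈ {σ} {σ'} {t} {t'} h e [] v | inj₂ nv =
  trans (sub-root σ t refl nv) (sym (sub-root σ' t' (sym (≈-root e)) nv))
sub-cong-≈ {σ} {σ'} {t} {t'} h e (j ∷ q) (there lt v) | inj₂ nv =
  trans (sub-child σ t refl nv j q)
  (trans (sub-cong-≈ (lifts^-cong-≈ h (binders (root t) j)) (≈-childˡ e (<arity-subst (sub-root σ t refl nv) lt))
                     q (Valid-≗ (sub-child σ t refl nv j) v))
         (sym (sub-child σ' t' (sym (≈-root e)) nv j q)))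

lifts-var : ∀ {ρ σ} → (∀ i → σ i ≈ tvar (ρ i)) → ∀ i → lifts σ i ≈ tvar (liftr ρ i)
lifts-var h zero        = ≈-refl
lifts-var {ρ} h (suc i) = ≈-trans (ren-cong-≈ (h i)) (≗⇒≈ (ren-tvar {suc} {ρ i}))

lifts^-var : ∀ {ρ σ} → (∀ i → σ i ≈ tvar (ρ i)) → ∀ m i → lifts^ m σ i ≈ tvar (liftr^ m ρ i)
lifts^-var h zero    = h
lifts^-var h (suc m) = lifts-var (lifts^-var h m)

ren≈sub : ∀ {ρ σ} → (∀ i → σ i ≈ tvar (ρ i)) → ∀ t → ren ρ t ≈ sub σ t
ren≈sub {ρ} {σ} h t p v with varOrNonVar (root t)
ren≈sub {ρ} {σ} h t [] v | inj₁ (i , eq) =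
  trans (cong (renLab ρ) eq) (sym (trans (sub-var σ t eq []) (h i [] here)))
ren≈sub {ρ} {σ} h t (j ∷ q) (there lt v) | inj₁ (i , eq) =
  contradiction (<arity-subst (cong (renLab ρ) eq) lt) n≮0
ren≈sub {ρ} {σ} h t [] v | inj₂ nv = trans (renLab-NonVar nv) (sym (sub-root σ t refl nv))
ren≈sub {ρ} {σ} h t (j ∷ q) (there lt v) | inj₂ nv =
  trans (ren≈sub (lifts^-var h (binders (root t) j)) (child t j) q v) (sym (sub-child σ t refl nv j q))

lifts-id : ∀ {σ} → (∀ i → σ i ≈ tvar i) → ∀ i → lifts σ i ≈ tvar i
lifts-id h zero    = ≈-refl
lifts-id h (suc i) = ≈-trans (ren-cong-≈ (h i)) (≗⇒≈ (ren-tvar {suc} {i}))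

lifts^-id : ∀ {σ} → (∀ i → σ i ≈ tvar i) → ∀ m i → lifts^ m σ i ≈ tvar i
lifts^-id h zero    = h
lifts^-id h (suc m) = lifts-id (lifts^-id h m)

sub-id : ∀ {σ} → (∀ i → σ i ≈ tvar i) → ∀ t → sub σ t ≈ t
sub-id {σ} h t p v with varOrNonVar (root t)
sub-id {σ} h t [] v | inj₁ (i , eq) = trans (sub-var σ t eq []) (trans (h i [] here) (sym eq))
sub-id {σ} h t (j ∷ q) (there lt v) | inj₁ (i , eq) =
  contradiction (<arity-subst (trans (sub-var σ t eq []) (h i [] here)) lt) n≮0
sub-id {σ} h t [] v | inj₂ nv = sub-root σ t refl nv
sub-id {σ} h t (j ∷ q) (there lt v) | inj₂ nv =
  trans (sub-child σ t refl nv j q)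
        (sub-id (lifts^-id h (binders (root t) j)) (child t j) q (Valid-≗ (sub-child σ t refl nv j) v))

listSub-pointwise : ∀ {ℓ} {R : Tm → Tm → Set ℓ} → (∀ i → R (tvar i) (tvar i))
                  → ∀ {as' as} → Pointwise R as' as → ∀ i → R (listSub as' i) (listSub as i)
listSub-pointwise r []       i       = r i
listSub-pointwise r (x ∷ xs) zero    = x
listSub-pointwise r (x ∷ xs) (suc i) = listSub-pointwise r xs i

listSub-cong-≈ : ∀ {as' as} → Pointwise _≈_ as' as → ∀ i → listSub as' i ≈ listSub as i
listSub-cong-≈ = listSub-pointwise {R = _≈_} (λ _ → ≈-refl)

ConApp-resp-≈ : ∀ {c w w' as} → ConApp c w as → w ≈ w'
              → ∃ λ as' → ConApp c w' as' × Pointwise _≈_ as' as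
ConApp-resp-≈ (nil e) f = [] , nil (trans (sym (≈-root f)) e) , []
ConApp-resp-≈ (snoc e ca) f with ConApp-resp-≈ ca (≈-childˡ f (<arity-subst (sym e) (s≤s z≤n)))
... | as' , ca' , pw =
  _ , snoc (trans (sym (≈-root f)) e) ca' , ≈-sym (≈-childˡ f (<arity-subst (sym e) (s≤s (s≤s z≤n)))) ∷ pw

⟶-respʳ-≈ : ∀ {t u u'} → t ⟶ u → u ≈ u' → t ⟶ u'
⟶-respʳ-≈ (β e0 e1 eu) e = β e0 e1 (≈-trans (≈-sym e) eu)
⟶-respʳ-≈ (ι {bs = bs} {d = d} k e0 lt ca len eu) e = ι {bs = bs} {d = d} k e0 lt ca len (≈-trans (≈-sym e) eu)
⟶-respʳ-≈ (ctx j er lt st others) e =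
  ctx j (trans er (≈-root e)) lt (⟶-respʳ-≈ st (≈-childˡ e (<arity-subst er lt)))
      (λ i li ne → ≈-trans (others i li ne) (≈-childˡ e (<arity-subst er li)))

⟶-respˡ-≈ : ∀ {t t' u} → t ≈ t' → t ⟶ u → t' ⟶ u
⟶-respˡ-≈ {t} e (β e0 e1 eu) =
  β (trans (sym (≈-root e)) e0) (trans (sym (≈-root e₀)) e1)
    (≈-trans eu (sub-cong-≈ (listSub-cong-≈ (e₁ ∷ [])) (≈-childˡ e₀ (<arity-subst (sym e1) (s≤s z≤n)))))
  where
  e₀ = ≈-childˡ e (<arity-subst (sym e0) (s≤s z≤n))
  e₁ = ≈-childˡ e (<arity-subst (sym e0) (s≤s (s≤s z≤n)))
⟶-respˡ-≈ e (ι {bs = bs} {d = d} k e0 lt ca len eu) with ConApp-resp-≈ ca (≈-childˡ e (<arity-subst (sym e0) (s≤s z≤n)))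
... | as' , ca' , pw =
  ι {bs = bs} {d = d} k (trans (sym (≈-root e)) e0) lt ca' (trans (Pointwise-length pw) len)
    (≈-trans eu (sub-cong-≈ (listSub-cong-≈ (symmetric ≈-sym pw))
                            (≈-childˡ e (<arity-subst (sym e0) (s≤s lt)))))
⟶-respˡ-≈ e (ctx j er lt st others) =
  ctx j (trans (sym (≈-root e)) er) (<arity-subst (≈-root e) lt) (⟶-respˡ-≈ (≈-childˡ e lt) st)
      (λ i li ne → ≈-trans (≈-sym (≈-childʳ e li)) (others i (<arity-subst (sym (≈-root e)) li) ne))

⟶*-respˡ-≈ : ∀ {t t' s} → t ≈ t' → t ⟶* s → ∃ λ s' → t' ⟶* s' × s' ≈ s
⟶*-respˡ-≈ e ε       = _ , ε , ≈-sym e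
⟶*-respˡ-≈ e (x ◅ r) = _ , ⟶-respˡ-≈ e x ◅ r , ≈-refl

_≈sub[_]_ : Tm → Subst → Tm → Set
a' ≈sub[ σ ] a = a' ≈ sub σ a

lifts^-listSub : ∀ {σ as' as m} → Pointwise _≈sub[ σ ]_ as' as → length as ≡ m
               → ∀ i → sub (listSub as') (lifts^ m σ i) ≈ sub σ (listSub as i)
lifts^-listSub {σ} []       refl i       = sub-id (λ _ → ≈-refl) (σ i)
lifts^-listSub     (x ∷ pw) refl zero    = x
lifts^-listSub {σ} {a' ∷ as'} {_ ∷ as} (x ∷ pw) refl (suc i) =
  ≈-trans (≗⇒≈ (sub-ren {suc} {listSub (a' ∷ as')} {listSub as'} (λ _ _ → refl) (lifts^ (length as) σ i)))
          (lifts^-listSub pw refl i)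

sub-listSub : ∀ {σ as' as m} → Pointwise _≈sub[ σ ]_ as' as → length as ≡ m → ∀ t
            → sub (listSub as') (sub (lifts^ m σ) t) ≈ sub σ (sub (listSub as) t)
sub-listSub pw len t =
  ≈-trans (≗⇒≈ (sub-sub (λ _ _ → refl) t))
  (≈-trans (sub-cong-≈ {t = t} (lifts^-listSub pw len) ≈-refl)
           (≗⇒≈ (λ p → sym (sub-sub (λ _ _ → refl) t p))))

ConApp-sub : ∀ σ {c s as} → ConApp c s as
           → ∃ λ as' → ConApp c (sub σ s) as' × Pointwise _≈sub[ σ ]_ as' as
ConApp-sub σ {s = s} (nil e) = [] , nil (sub-root σ s e (nvCon _)) , []
ConApp-sub σ {s = s} (snoc e ca) with ConApp-sub σ ca
... | as₁ , ca₁ , pw₁ with ConApp-resp-≈ ca₁ (≗⇒≈ (λ p → sym (sub-child σ s e nvApp 0 p)))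
... | as₂ , ca₂ , pw₂ =
  _ , snoc (sub-root σ s e nvApp) ca₂ , ≗⇒≈ (sub-child σ s e nvApp 1) ∷ transitive ≈-trans pw₂ pw₁

sub-⟶ : ∀ σ {t u} → t ⟶ u → sub σ t ⟶ sub σ u
sub-⟶ σ {t} (β e0 e1 eu) =
  ⟶-respʳ-≈ (β (sub-root σ t e0 nvApp) (trans (sub-child σ t e0 nvApp 0 []) (sub-root σ (child t 0) e1 nvLam)) ≈-refl)
    (≈-trans (sub-cong-≈ (listSub-cong-≈ (≗⇒≈ (sub-child σ t e0 nvApp 1) ∷ [])) (≗⇒≈ body))
    (≈-trans (sub-listSub (≈-refl ∷ []) refl (child (child t 0) 0))
             (sub-cong-≈ (λ _ → ≈-refl) (≈-sym eu))))
  where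
  body : child (child (sub σ t) 0) 0 ≗ sub (lifts σ) (child (child t 0) 0)
  body p = trans (sub-child σ t e0 nvApp 0 (0 ∷ p)) (sub-child σ (child t 0) e1 nvLam 0 p)
sub-⟶ σ {t} (ι {bs = bs} {d = d} k e0 lt ca len eu) with ConApp-sub σ ca
... | as₁ , ca₁ , pw₁ with ConApp-resp-≈ ca₁ (≗⇒≈ (λ p → sym (sub-child σ t e0 (nvCase bs d) 0 p)))
... | as₂ , ca₂ , pw₂ =
  ⟶-respʳ-≈ (ι {bs = bs} {d = d} k (sub-root σ t e0 (nvCase bs d)) lt ca₂ (trans (Pointwise-length pw) len) ≈-refl)
    (≈-trans (sub-cong-≈ (λ _ → ≈-refl) (≗⇒≈ (sub-child σ t e0 (nvCase bs d) (suc k))))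
    (≈-trans (sub-listSub pw len (child t (suc k)))
             (sub-cong-≈ (λ _ → ≈-refl) (≈-sym eu))))
  where pw = transitive ≈-trans pw₂ pw₁
sub-⟶ σ {t} {u} (ctx j er lt st others) =
  ctx j (trans (sub-root σ t refl nv) (sym (sub-root σ u (sym er) nv)))
      (<arity-subst (sym (sub-root σ t refl nv)) lt)
      (⟶-respˡ-≈ (≗⇒≈ (λ p → sym (sub-child σ t refl nv j p)))
        (⟶-respʳ-≈ (sub-⟶ (lifts^ (binders (root t) j) σ) st) (≗⇒≈ (λ p → sym (sub-child σ u (sym er) nv j p)))))
      (λ i li ne → ≈-trans (≗⇒≈ (sub-child σ t refl nv i))
                   (≈-trans (sub-cong-≈ (λ _ → ≈-refl) (others i (<arity-subst (sub-root σ t refl nv) li) ne))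
                            (≗⇒≈ (λ p → sym (sub-child σ u (sym er) nv i p)))))
  where nv = <arity⇒NonVar lt

sub-⟶* : ∀ σ {t u} → t ⟶* u → sub σ t ⟶* sub σ u
sub-⟶* σ ε       = ε
sub-⟶* σ (x ◅ r) = sub-⟶ σ x ◅ sub-⟶* σ r

-- Coinduction for →∞

Φᵘ : ∀ {ℓ} → (Tm → Tm → Set ℓ) → Tm → Tm → Set ℓ
Φᵘ R x y = ∃ λ s → x ⟶* s × root s ≡ root y × (∀ j → j < arity (root y) → R (child s j) (child y j))

Φᵘ-map : ∀ {ℓ ℓ'} {R : Tm → Tm → Set ℓ} {R' : Tm → Tm → Set ℓ'}
       → (∀ {a b} → R a b → R' a b) → ∀ {x y} → Φᵘ R x y → Φᵘ R' x y
Φᵘ-map g (s , st , er , f) = s , st , er , λ j lt → g (f j lt)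

Φ⇒Φᵘ : ∀ {R x y} → Φ R x y → Φᵘ R x y
Φ⇒Φᵘ (atom (inj₁ (i , e)) st er) = _ , st , er , λ j lt → contradiction (<arity-subst e lt) n≮0
Φ⇒Φᵘ (atom (inj₂ (c , e)) st er) = _ , st , er , λ j lt → contradiction (<arity-subst e lt) n≮0
Φ⇒Φᵘ {R} {y = y} (lam {s} e st es r) = _ , st , trans es (sym e) , children
  where
  children : ∀ j → j < arity (root y) → R (child s j) (child y j)
  children zero _ = r
  children (suc j) lt with <arity-subst e lt
  ... | s≤s ()
Φ⇒Φᵘ {R} {y = y} (app {s} e st es r₀ r₁) = _ , st , trans es (sym e) , children
  where
  children : ∀ j → j < arity (root y) → R (child s j) (child y j)
  children zero          _ = r₀
  children (suc zero)    _ = r₁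
  children (suc (suc j)) lt with <arity-subst e lt
  ... | s≤s (s≤s ())
Φ⇒Φᵘ {R} {y = y} (case {s} e st es r₀ rs) = _ , st , trans es (sym e) , children
  where
  children : ∀ j → j < arity (root y) → R (child s j) (child y j)
  children zero    _ = r₀
  children (suc k) lt with <arity-subst e lt
  ... | s≤s k< = rs k k<

-- The uniqueness proof in a case label is irrelevant, while Φ.case asks for a
-- relevant one; it is recomputed by deciding uniqueness.
Φᵘ⇒Φ : ∀ {R x y} → Φᵘ R x y → Φ R x y
Φᵘ⇒Φ {y = y} (s , st , er , f) with root y in eq
... | var i     = atom (inj₁ (i , eq)) st (trans er (sym eq))
... | con c     = atom (inj₂ (c , eq)) st (trans er (sym eq))
... | lam       = lam eq st er (f 0 (s≤s z≤n))
... | app       = app eq st er (f 0 (s≤s z≤n)) (f 1 (s≤s (s≤s z≤n)))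
... | case bs d =
  case {d = d'} {d' = d'} eq st er (f 0 (s≤s z≤n)) (λ k lt → f (suc k) (s≤s lt))
  where d' = recompute (unique? (map proj₁ bs)) d

PostFixed : (Tm → Tm → Set) → Set
PostFixed R = ∀ {a b} → R a b → Φᵘ R a b

postFixed⇒→∞ : ∀ {R} → PostFixed R → ∀ {a b} → R a b → a →∞ b
postFixed⇒→∞ {R} post r = R , (λ _ _ r → Φᵘ⇒Φ (post r)) , r

→∞-postFixed : ∀ {x y} (h : x →∞ y) → PostFixed (proj₁ h)
→∞-postFixed (R , post , _) r = Φ⇒Φᵘ (post _ _ r)

→∞-family : ∀ {I : Set} {x y : I → Tm} → (∀ i → x i →∞ y i)
          → ∃ λ (R : Tm → Tm → Set) → PostFixed R × (∀ i → R (x i) (y i))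
→∞-family {I} hs = R , post , λ i → i , proj₂ (proj₂ (hs i))
  where
  R : Tm → Tm → Set
  R a b = Σ I λ i → proj₁ (hs i) a b
  post : PostFixed R
  post {a} {b} (i , r) = Φᵘ-map {R = proj₁ (hs i)} {R' = R} (i ,_) {a} {b} (→∞-postFixed (hs i) {a} {b} r)

→∞-unfold : ∀ {x y} → x →∞ y → Φᵘ _→∞_ x y
→∞-unfold {x} {y} h@(R , _ , r) =
  Φᵘ-map {R = R} (λ {a} {b} → postFixed⇒→∞ {R} (→∞-postFixed {x} {y} h) {a} {b}) {x} {y}
         (→∞-postFixed {x} {y} h {x} {y} r)

→∞-fold : ∀ {x y} → Φᵘ _→∞_ x y → x →∞ y
→∞-fold {x} {y} (s , st , er , f) with →∞-family {I = ∃ λ j → j < arity (root y)} (λ (j , lt) → f j lt)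
... | R , post , r = postFixed⇒→∞ {R⁺} post⁺ (inj₂ (refl , refl))
  where
  R⁺ : Tm → Tm → Set
  R⁺ a b = R a b ⊎ (a ≡ x × b ≡ y)
  post⁺ : PostFixed R⁺
  post⁺ {a} {b} (inj₁ r')   = Φᵘ-map {R = R} {R' = R⁺} inj₁ {a} {b} (post {a} {b} r')
  post⁺ (inj₂ (refl , refl)) = s , st , er , λ j lt → inj₁ (r (j , lt))

≈⇒→∞ : ∀ {x y} → x ≈ y → x →∞ y
≈⇒→∞ = postFixed⇒→∞ {_≈_} (λ e → _ , ε , ≈-root e , λ j lt → ≈-childʳ e lt)

→∞-expand : ∀ {x a' a b y} → x ⟶* a' → a' ≈ a → a →∞ b → b ≈ y → x →∞ y
→∞-expand st ea h eb = postFixed⇒→∞ {Expansion} expand (_ , _ , _ , st , ea , proj₂ (proj₂ h) , eb)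
  where
  Expansion : Tm → Tm → Set
  Expansion x y = ∃ λ a' → ∃ λ a → ∃ λ b → x ⟶* a' × a' ≈ a × proj₁ h a b × b ≈ y
  expand : PostFixed Expansion
  expand (_ , _ , _ , st , ea , r , eb) with →∞-postFixed h r
  ... | s , st₁ , er , f with ⟶*-respˡ-≈ (≈-sym ea) st₁
  ... | s' , st₂ , e = s' , st ◅◅ st₂ , trans (≈-root e) (trans er (≈-root eb)) , λ j lt →
    let lt' = <arity-subst (sym (≈-root eb)) lt in
    _ , _ , _ , ε , ≈-childʳ e (<arity-subst (sym er) lt') , f j lt' , ≈-childʳ eb lt

-- Infinitary reduction is closed under substitution

module _ {R : Tm → Tm → Set} (post : PostFixed R) where

  data SubClosure : Tm → Tm → Set where
    by-≈   : ∀ {x y} → x ≈ y → SubClosure x y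
    by-R   : ∀ {x y a b} → R a b → x ≈ a → b ≈ y → SubClosure x y
    by-sub : ∀ {x y a b} (σ₀ σ : Subst) → (∀ i → SubClosure (σ₀ i) (σ i)) → SubClosure a b
           → x ≈ sub σ₀ a → sub σ b ≈ y → SubClosure x y

  SubClosure-base : ∀ {a b} → R a b → SubClosure a b
  SubClosure-base {a} {b} r = by-R {a} {b} {a} {b} r ≈-refl ≈-refl

  SubClosure-resp-≈ : ∀ {x' x y y'} → x' ≈ x → SubClosure x y → y ≈ y' → SubClosure x' y'
  SubClosure-resp-≈ e (by-≈ f)                g = by-≈ (≈-trans e (≈-trans f g))
  SubClosure-resp-≈ e (by-R r f h)            g = by-R r (≈-trans e f) (≈-trans h g)
  SubClosure-resp-≈ e (by-sub σ₀ σ hσ ab f h) g = by-sub σ₀ σ hσ ab (≈-trans e f) (≈-trans h g)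

  SubClosure-lifts : ∀ {σ₀ σ} → (∀ i → SubClosure (σ₀ i) (σ i)) → ∀ i → SubClosure (lifts σ₀ i) (lifts σ i)
  SubClosure-lifts h zero = by-≈ ≈-refl
  SubClosure-lifts {σ₀} {σ} h (suc i) =
    by-sub (tvar ∘ suc) (tvar ∘ suc) (λ _ → by-≈ ≈-refl) (h i)
           (ren≈sub (λ _ → ≈-refl) (σ₀ i)) (≈-sym (ren≈sub (λ _ → ≈-refl) (σ i)))

  SubClosure-lifts^ : ∀ {σ₀ σ} → (∀ i → SubClosure (σ₀ i) (σ i)) → ∀ m i → SubClosure (lifts^ m σ₀ i) (lifts^ m σ i)
  SubClosure-lifts^ h zero    = h
  SubClosure-lifts^ h (suc m) = SubClosure-lifts (SubClosure-lifts^ h m)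

  -- If a reduces to a term with the variable i at the root, as b has, then
  -- σ₀ a reduces to σ₀ i and the pair (σ₀ i, σ i) takes over.
  SubClosure-postFixed : PostFixed SubClosure
  SubClosure-postFixed (by-≈ e) = _ , ε , ≈-root e , λ j lt → by-≈ (≈-childʳ e lt)
  SubClosure-postFixed (by-R r ea eb) with post r
  ... | s , st , er , f with ⟶*-respˡ-≈ (≈-sym ea) st
  ... | s' , st' , e' = s' , st' , trans (≈-root e') (trans er (≈-root eb)) , λ j lt →
    let lt' = <arity-subst (sym (≈-root eb)) lt in
    by-R (f j lt') (≈-childʳ e' (<arity-subst (sym er) lt')) (≈-childʳ eb lt)
  SubClosure-postFixed (by-sub {b = b} σ₀ σ hσ ab ex ey) with SubClosure-postFixed ab
  ... | s , st , er , f with ⟶*-respˡ-≈ (≈-sym ex) (sub-⟶* σ₀ st) | varOrNonVar (root b)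
  ... | s₁ , st₁ , e₁ | inj₁ (i , eq) with SubClosure-postFixed (hσ i)
  ... | s₂ , st₂ , er₂ , f₂ with ⟶*-respˡ-≈ (≈-sym (≈-trans e₁ (≗⇒≈ (sub-var σ₀ s (trans er eq))))) st₂
  ... | s₃ , st₃ , e₃ = s₃ , st₁ ◅◅ st₃ , trans (≈-root e₃) (trans er₂ (≈-root ey')) , λ j lt →
    let lt' = <arity-subst (sym (≈-root ey')) lt in
    SubClosure-resp-≈ (≈-childʳ e₃ (<arity-subst (sym er₂) lt')) (f₂ j lt') (≈-childʳ ey' lt)
    where
    ey' : σ i ≈ _
    ey' = ≈-trans (≗⇒≈ (λ p → sym (sub-var σ b eq p))) ey
  SubClosure-postFixed (by-sub {b = b} σ₀ σ hσ ab ex ey) | s , st , er , f | s₁ , st₁ , e₁ | inj₂ nv =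
    s₁ , st₁ , er₁ , λ j lt →
      let m = binders (root b) j
          lt' = <arity-subst (sym (trans (sym (sub-root σ b refl nv)) (≈-root ey))) lt in
      by-sub (lifts^ m σ₀) (lifts^ m σ) (SubClosure-lifts^ hσ m) (f j lt')
             (≈-trans (≈-childʳ e₁ (<arity-subst (sym (sub-root σ₀ s er nv)) lt'))
                      (≗⇒≈ (sub-child σ₀ s er nv j)))
             (≈-trans (≗⇒≈ (λ p → sym (sub-child σ b refl nv j p))) (≈-childʳ ey lt))
    where
    er₁ = trans (≈-root e₁) (trans (sub-root σ₀ s er nv) (trans (sym (sub-root σ b refl nv)) (≈-root ey)))

→∞-sub : ∀ {a b σ₀ σ} → a →∞ b → (∀ i → σ₀ i →∞ σ i) → sub σ₀ a →∞ sub σ b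
→∞-sub {a} {b} {σ₀} {σ} h hσ with →∞-family {I = Maybe ℕ} {maybe σ₀ a} {maybe σ b} (λ { nothing → h ; (just i) → hσ i })
... | R , post , r =
  postFixed⇒→∞ {SubClosure post} (SubClosure-postFixed post)
    (by-sub {a = a} {b = b} σ₀ σ (λ i → SubClosure-base post (r (just i))) (SubClosure-base post (r nothing)) ≈-refl ≈-refl)

replaceChild : Tm → ℕ → Tm → Tm
replaceChild s j x []      = s []
replaceChild s j x (i ∷ p) with i ≟ j
... | yes _ = x p
... | no  _ = s (i ∷ p)

replaceChild-≡ : ∀ s j x → child (replaceChild s j x) j ≗ x
replaceChild-≡ s j x p with j ≟ j
... | yes _   = refl
... | no  j≢j = contradiction refl j≢j

replaceChild-≢ : ∀ s j x {i} → i ≢ j → child (replaceChild s j x) i ≗ child s i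
replaceChild-≢ s j x {i} i≢j p with i ≟ j
... | yes i≡j = contradiction i≡j i≢j
... | no  _   = refl

⟶*-inside : ∀ {s j x w} → j < arity (root s) → child s j ≈ x → x ⟶* w
          → ∃ λ s' → s ⟶* s' × root s' ≡ root s × child s' j ≈ w × (∀ i → i ≢ j → child s' i ≈ child s i)
⟶*-inside {s} lt e ε = s , ε , refl , e , λ _ _ → ≈-refl
⟶*-inside {s} {j} lt e (_◅_ {j = y} x⟶y r) with ⟶*-inside {replaceChild s j y} lt (≗⇒≈ (replaceChild-≡ s j y)) r
... | s' , st , er , e' , others =
  s' , step ◅ st , er , e' , λ i i≢j → ≈-trans (others i i≢j) (≗⇒≈ (replaceChild-≢ s j y i≢j))
  where
  step : s ⟶ replaceChild s j y
  step = ctx j refl lt (⟶-respʳ-≈ (⟶-respˡ-≈ (≈-sym e) x⟶y) (≗⇒≈ (λ p → sym (replaceChild-≡ s j y p))))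
             (λ i _ i≢j → ≗⇒≈ (λ p → sym (replaceChild-≢ s j y i≢j p)))

-- Redexes in the limit of an infinitary reduction

→∞-respˡ-≈ : ∀ {a a' b} → a ≈ a' → a' →∞ b → a →∞ b
→∞-respˡ-≈ e h = →∞-expand ε e h ≈-refl

→∞-respʳ-≈ : ∀ {a b b'} → a →∞ b → b ≈ b' → a →∞ b'
→∞-respʳ-≈ h e = →∞-expand ε ≈-refl h e

listSub-→∞ : ∀ {as' as} → Pointwise _→∞_ as' as → ∀ i → listSub as' i →∞ listSub as i
listSub-→∞ = listSub-pointwise {R = _→∞_} (λ _ → ≈⇒→∞ ≈-refl)

→∞-ConApp : ∀ {c x y as} → x →∞ y → ConApp c y as
          → ∃ λ w → ∃ λ as₀ → x ⟶* w × ConApp c w as₀ × Pointwise _→∞_ as₀ as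
→∞-ConApp h (nil e) with →∞-unfold h
... | s , st , er , _ = s , [] , st , nil (trans er e) , []
→∞-ConApp h (snoc e ca) with →∞-unfold h
... | s , st , er , f with →∞-ConApp (f 0 (<arity-subst (sym e) (s≤s z≤n))) ca
... | w , as₀ , st₀ , ca₀ , hs with ⟶*-inside {s} {0} (<arity-subst (sym (trans er e)) (s≤s z≤n)) ≈-refl st₀
... | s' , st' , er' , e' , others with ConApp-resp-≈ ca₀ (≈-sym e')
... | as₁ , ca₁ , es =
  s' , _ , st ◅◅ st' , snoc (trans er' (trans er e)) ca₁ ,
  →∞-respˡ-≈ (others 1 (λ ())) (f 1 (<arity-subst (sym e) (s≤s (s≤s z≤n)))) ∷ transitive →∞-respˡ-≈ es hs

→∞-β : ∀ {t t'} → t →∞ t' → root t' ≡ app → root (child t' 0) ≡ lam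
     → t →∞ sub (listSub (child t' 1 ∷ [])) (child (child t' 0) 0)
→∞-β h e0 e1 with →∞-unfold h
... | s , st , er , f with →∞-unfold (f 0 (<arity-subst (sym e0) (s≤s z≤n)))
... | s₀ , st₀ , er₀ , f₀ with ⟶*-inside {s} {0} (<arity-subst (sym (trans er e0)) (s≤s z≤n)) ≈-refl st₀
... | s' , st' , er' , e' , others =
  →∞-expand (st ◅◅ st' ◅◅ contract ◅ ε)
            (sub-cong-≈ (listSub-cong-≈ (others 1 (λ ()) ∷ [])) (≈-childʳ e' (<arity-subst (sym (trans er₀ e1)) (s≤s z≤n))))
            (→∞-sub (f₀ 0 (<arity-subst (sym e1) (s≤s z≤n)))
                    (listSub-→∞ (f 1 (<arity-subst (sym e0) (s≤s (s≤s z≤n))) ∷ [])))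
            ≈-refl
  where
  contract : s' ⟶ sub (listSub (child s' 1 ∷ [])) (child (child s' 0) 0)
  contract = β (trans er' (trans er e0)) (trans (≈-root e') (trans er₀ e1)) ≈-refl

→∞-ι : ∀ {t t' bs d as} k → t →∞ t' → root t' ≡ case bs d → k < length bs
     → ConApp (nthCon bs k) (child t' 0) as → length as ≡ nthArity bs k
     → t →∞ sub (listSub as) (child t' (suc k))
→∞-ι {bs = bs} {d} k h e0 lt ca len with →∞-unfold h
... | s , st , er , f with →∞-ConApp (f 0 (<arity-subst (sym e0) (s≤s z≤n))) ca
... | w , as₀ , st₀ , ca₀ , hs with ⟶*-inside {s} {0} (<arity-subst (sym (trans er e0)) (s≤s z≤n)) ≈-refl st₀
... | s' , st' , er' , e' , others with ConApp-resp-≈ ca₀ (≈-sym e')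
... | as₁ , ca₁ , es =
  →∞-expand (st ◅◅ st' ◅◅ contract ◅ ε) ≈-refl
            (→∞-sub (→∞-respˡ-≈ (others (suc k) (λ ())) (f (suc k) (<arity-subst (sym e0) (s≤s lt))))
                    (listSub-→∞ (transitive →∞-respˡ-≈ es hs)))
            ≈-refl
  where
  contract : s' ⟶ sub (listSub as₁) (child s' (suc k))
  contract = ι {bs = bs} {d = d} k (trans er' (trans er e0)) lt ca₁
               (trans (Pointwise-length es) (trans (Pointwise-length hs) len)) ≈-refl

lemma2p3 : ∀ {t t' t'' : Tm} → t →∞ t' → t' ⟶ t'' → t →∞ t''
lemma2p3 h (β e0 e1 eu)                 = →∞-respʳ-≈ (→∞-β h e0 e1) (≈-sym eu)
lemma2p3 h (ι {d = d} k e0 lt ca len eu) = →∞-respʳ-≈ (→∞-ι {d = d} k h e0 lt ca len) (≈-sym eu)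
lemma2p3 {t'' = t''} h (ctx j er lt st others) with →∞-unfold h
... | s , st₀ , er₀ , f = →∞-fold (s , st₀ , trans er₀ er , children)
  where
  children : ∀ i → i < arity (root t'') → child s i →∞ child t'' i
  children i li with i ≟ j
  ... | yes refl = lemma2p3 (f i lt) st
  ... | no  i≢j  = →∞-respʳ-≈ (f i li') (others i li' i≢j)
    where li' = <arity-subst (sym er) li
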